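{- Let $G$ be a finite connected graph with clique number $\omega(G)$, and suppose there is an integer $r$ such that every vertex $v$ belonging to any largest clique of $G$ (a clique with $\omega(G)$ vertices) has degree $d_G(v) = r$. Then $$\eta_{dl}(G) \ge \left\lceil \frac{r + 1}{r - \omega(G) + 2}\right\rceil\,.$$
   Context: For a graph $G$, $N(u)$ denotes the open neighborhood of a vertex $u$ and $d_G(u)$ its degree. Given a vertex labeling $\ell: V(G)\to \mathbb{N}$ (positive integers), the $d$-lucky sum of $u$ is $d_\ell(u) = d_G(u) + \sum_{v\in N(u)}\ell(v)$. The labeling $\ell$ is a $d$-lucky labeling if $d_\ell(u)\neq d_\ell(v)$ for every edge $uv\in E(G)$. The $d$-lucky number $\eta_{dl}(G)$ is the least positive integer $k$ such that $G$ admits a $d$-lucky labeling $V(G)\to\{1,\dots,k\}$. -}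

module Defs where

open import Data.Nat using (ℕ; zero; suc; _+_; _*_; _∸_; _≤_; _/_)
open import Data.Bool using (Bool; true; false; if_then_else_)
open import Data.Fin using (Fin)
open import Data.Fin.Subset using (Subset; _∈_; ∣_∣)
open import Data.List using (List; map; allFin)
open import Data.Nat.ListAction using (sum)
open import Data.Product using (Σ; _×_; ∃)
open import Relation.Binary.PropositionalEquality using (_≡_; _≢_)
open import Relation.Nullary using (¬_)

record Graph : Set where
  field
    n     : ℕ
    adj   : Fin n → Fin n → Bool
    sym   : ∀ u v → adj u v ≡ adj v u
    irref : ∀ u → adj u u ≡ false
open Graph public

Σv : (G : Graph) → (Fin (n G) → ℕ) → ℕ
Σv G f = sum (map f (allFin (n G)))

deg : (G : Graph) → Fin (n G) → ℕ
deg G u = Σv G (λ v → if adj G u v then 1 else 0)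

data Reach (G : Graph) : Fin (n G) → Fin (n G) → Set where
  here : ∀ {u} → Reach G u u
  step : ∀ {u w v} → adj G u w ≡ true → Reach G w v → Reach G u v

Connected : Graph → Set
Connected G = ∀ u v → Reach G u v

IsClique : (G : Graph) → Subset (n G) → Set
IsClique G S = ∀ u v → u ∈ S → v ∈ S → u ≢ v → adj G u v ≡ true

IsCliqueNumber : Graph → ℕ → Set
IsCliqueNumber G w =
  (Σ (Subset (n G)) λ S → IsClique G S × ∣ S ∣ ≡ w) ×
  (∀ S → IsClique G S → ∣ S ∣ ≤ w)

dsum : (G : Graph) → (Fin (n G) → ℕ) → Fin (n G) → ℕ
dsum G ℓ u = deg G u + Σv G (λ v → if adj G u v then ℓ v else 0)

IsDLucky : (G : Graph) → (Fin (n G) → ℕ) → Set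
IsDLucky G ℓ = ∀ u v → adj G u v ≡ true → ¬ (dsum G ℓ u ≡ dsum G ℓ v)

AdmitsDLucky : Graph → ℕ → Set
AdmitsDLucky G k =
  Σ (Fin (n G) → ℕ) λ ℓ → (∀ v → 1 ≤ ℓ v × ℓ v ≤ k) × IsDLucky G ℓ

IsDLuckyNumber : Graph → ℕ → Set
IsDLuckyNumber G k =
  1 ≤ k × AdmitsDLucky G k × (∀ j → 1 ≤ j → AdmitsDLucky G j → k ≤ j)

-- ceiling division ⌈a / b⌉ (b = 0 is given the junk value 0; never used below)
⌈_/_⌉ : ℕ → ℕ → ℕ
⌈ a / zero ⌉ = 0
⌈ a / suc b ⌉ = (a + b) / suc b

module Submission where

-- Fix a maximum clique S (so ∣S∣ = ω), a d-lucky labelling ℓ with labels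
-- in {1,…,k}, write m = r + 1 − ω and L = Σ_{u∈S} ℓ(u).  A vertex v ∈ S is adjacent to the
-- other ω − 1 vertices of S and, having degree r, to exactly m vertices outside S.  Hence
--     d_ℓ(v) + ℓ(v) = r + L + X_v,   where X_v = Σ_{u ∈ N(v)∖S} ℓ(u) satisfies m ≤ X_v ≤ k·m,
-- so the ω values d_ℓ(v) + k (v ∈ S) lie in the window [r+L+m, r+L+k(m+1)).  They are pairwise
-- distinct because S is a clique and ℓ is d-lucky, so by pigeonhole ω + m ≤ k(m+1), i.e.
-- r + 1 ≤ k(m+1), which is the ceiling bound.

open import Defs hiding (sym)
open import Data.Nat.Properties
  using (+-*-semiring; +-identityʳ; +-assoc; +-comm; +-suc; *-zeroʳ; *-identityʳ; *-suc;
         +-mono-≤; +-monoˡ-≤; +-monoʳ-≤; +-monoˡ-<; +-mono-≤-<; +-cancelˡ-≤; +-cancelˡ-≡;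
         +-cancelʳ-≡; ≤-trans; ≤-pred; <⇒≤; n≤1+n; n<1+n; m<m+n; m≤n*m; suc-injective; 0≢1+n;
         m∸n+n≡m; m+[n∸m]≡n; m∸n≢0⇒n<m; ∸-monoˡ-<; ∸-cancelʳ-≡; module ≤-Reasoning)
open import Algebra.Properties.Semiring.Sum +-*-semiring
  using (sum-syntax; sum-cong-≗; sum-replicate-zero; ∑-distrib-+; *-distribˡ-sum)
open import Data.Bool using (Bool; true; false; not; _∧_; _∨_; if_then_else_)
open import Data.Bool.Properties using (∧-zeroʳ; ∨-identityʳ)
open import Data.Fin using (Fin; zero; suc; toℕ; fromℕ<)
open import Data.Fin.Properties using (toℕ-fromℕ<; injective⇒≤)
  renaming (_≟_ to _≟ᶠ_; suc-injective to fin-suc-injective)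
open import Data.Fin.Subset using (Subset; _∈_; ∣_∣)
open import Data.List using (tabulate)
open import Data.List.Properties using (map-tabulate)
open import Data.Nat using (ℕ; zero; suc; _+_; _*_; _∸_; _≤_; _<_; z≤n; >-nonZero)
open import Data.Nat.DivMod using (m<n*o⇒m/o<n)
open import Data.Nat.ListAction using (sum)
open import Data.Empty using (⊥-elim)
open import Data.Product using (_×_; _,_; proj₁; proj₂)
open import Data.Vec using ([]; _∷_; lookup; here; there)
open import Data.Vec.Properties using ([]=⇒lookup; lookup⇒[]=)
open import Function using (id; _∘_)
open import Relation.Nullary using (does; yes; no)
open import Relation.Binary.PropositionalEquality
  using (_≡_; refl; sym; trans; cong; cong₂; subst; module ≡-Reasoning)

sum-tabulate : ∀ {m} (f : Fin m → ℕ) → sum (tabulate f) ≡ ∑[ u < m ] f u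
sum-tabulate {zero}  f = refl
sum-tabulate {suc m} f = cong (f zero +_) (sum-tabulate (f ∘ suc))

Σv≡∑ : (G : Graph) (f : Fin (n G) → ℕ) → Σv G f ≡ ∑[ u < n G ] f u
Σv≡∑ G f = trans (cong sum (map-tabulate id f)) (sum-tabulate f)

∑-mono : ∀ {m} {f g : Fin m → ℕ} → (∀ u → f u ≤ g u) → ∑[ u < m ] f u ≤ ∑[ u < m ] g u
∑-mono {zero}  f≤g = z≤n
∑-mono {suc m} f≤g = +-mono-≤ (f≤g zero) (∑-mono (f≤g ∘ suc))

sumWhere : ∀ {m} → (Fin m → Bool) → (Fin m → ℕ) → ℕ
sumWhere {m} p f = ∑[ u < m ] (if p u then f u else 0)

count : ∀ {m} → (Fin m → Bool) → ℕ
count p = sumWhere p (λ _ → 1)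

sumWhere-cong : ∀ {m} {p q : Fin m → Bool} (f : Fin m → ℕ) → (∀ u → p u ≡ q u) →
                sumWhere p f ≡ sumWhere q f
sumWhere-cong f p≡q = sum-cong-≗ (λ u → cong (λ b → if b then f u else 0) (p≡q u))

sumWhere-∨ : ∀ {m} (p q : Fin m → Bool) (f : Fin m → ℕ) → (∀ u → p u ∧ q u ≡ false) →
             sumWhere (λ u → p u ∨ q u) f ≡ sumWhere p f + sumWhere q f
sumWhere-∨ p q f disjoint =
  trans (sum-cong-≗ (λ u → split (p u) (q u) (f u) (disjoint u))) (∑-distrib-+ (λ u → if p u then f u else 0) (λ u → if q u then f u else 0))
  where
  split : ∀ a b x → a ∧ b ≡ false →
          (if a ∨ b then x else 0) ≡ (if a then x else 0) + (if b then x else 0)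
  split true  false x _ = sym (+-identityʳ x)
  split false b     x _ = refl

sumWhere-point : ∀ {m} (v : Fin m) (f : Fin m → ℕ) → sumWhere (λ u → does (u ≟ᶠ v)) f ≡ f v
sumWhere-point {suc m} zero    f = trans (cong (f zero +_) (sum-replicate-zero m)) (+-identityʳ _)
sumWhere-point {suc m} (suc v) f = sumWhere-point v (f ∘ suc)

sumWhere-scale : ∀ {m} (p : Fin m → Bool) (k : ℕ) (f : Fin m → ℕ) →
                 sumWhere p (λ u → k * f u) ≡ k * sumWhere p f
sumWhere-scale p k f = trans (sum-cong-≗ (λ u → pull (p u) (f u))) (sym (*-distribˡ-sum k (λ u → if p u then f u else 0)))
  where
  pull : ∀ b x → (if b then k * x else 0) ≡ k * (if b then x else 0)
  pull true  x = refl
  pull false x = sym (*-zeroʳ k)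

sumWhere-bounds : ∀ {m} (p : Fin m → Bool) (ℓ : Fin m → ℕ) (k : ℕ) → (∀ u → 1 ≤ ℓ u × ℓ u ≤ k) →
                  count p ≤ sumWhere p ℓ × sumWhere p ℓ ≤ k * count p
sumWhere-bounds p ℓ k labels =
  ∑-mono (λ u → lower (p u) (proj₁ (labels u))) ,
  subst (sumWhere p ℓ ≤_) (sumWhere-scale p k (λ _ → 1))
        (∑-mono (λ u → upper (p u) (proj₂ (labels u))))
  where
  lower : ∀ b {x} → 1 ≤ x → (if b then 1 else 0) ≤ (if b then x else 0)
  lower true  1≤x = 1≤x
  lower false _   = z≤n
  upper : ∀ b {x} → x ≤ k → (if b then x else 0) ≤ (if b then k * 1 else 0)
  upper true  x≤k = subst (_ ≤_) (sym (*-identityʳ k)) x≤k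
  upper false _   = z≤n

count-lookup : ∀ {m} (S : Subset m) → count (lookup S) ≡ ∣ S ∣
count-lookup []          = refl
count-lookup (true ∷ S)  = cong suc (count-lookup S)
count-lookup (false ∷ S) = count-lookup S

deg≡count : (G : Graph) (v : Fin (n G)) → deg G v ≡ count (adj G v)
deg≡count G v = Σv≡∑ G _

dsum≡sumWhere : (G : Graph) (ℓ : Fin (n G) → ℕ) (v : Fin (n G)) →
                dsum G ℓ v ≡ count (adj G v) + sumWhere (adj G v) ℓ
dsum≡sumWhere G ℓ v = cong₂ _+_ (Σv≡∑ G _) (Σv≡∑ G _)

element : ∀ {m} (S : Subset m) → Fin ∣ S ∣ → Fin m
element (true ∷ S)  zero    = zero
element (true ∷ S)  (suc i) = suc (element S i)
element (false ∷ S) i       = suc (element S i)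

element-∈ : ∀ {m} (S : Subset m) (i : Fin ∣ S ∣) → element S i ∈ S
element-∈ (true ∷ S)  zero    = here
element-∈ (true ∷ S)  (suc i) = there (element-∈ S i)
element-∈ (false ∷ S) i       = there (element-∈ S i)

element-injective : ∀ {m} (S : Subset m) {i j : Fin ∣ S ∣} → element S i ≡ element S j → i ≡ j
element-injective (true ∷ S)  {zero}  {zero}  _ = refl
element-injective (true ∷ S)  {suc i} {suc j} e = cong suc (element-injective S (fin-suc-injective e))
element-injective (false ∷ S)                 e = element-injective S (fin-suc-injective e)

InjectiveOn : ∀ {m} → Subset m → (Fin m → ℕ) → Set
InjectiveOn S h = ∀ {u w} → u ∈ S → w ∈ S → h u ≡ h w → u ≡ w

pigeonhole : ∀ {m} (S : Subset m) (h : Fin m → ℕ) (c : ℕ) →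
             (∀ {u} → u ∈ S → h u < c) → InjectiveOn S h → ∣ S ∣ ≤ c
pigeonhole S h c bounded injective = injective⇒≤ {f = code} code-injective
  where
  code : Fin ∣ S ∣ → Fin c
  code i = fromℕ< (bounded (element-∈ S i))
  code-injective : ∀ {i j} → code i ≡ code j → i ≡ j
  code-injective {i} {j} e = element-injective S
    (injective (element-∈ S i) (element-∈ S j)
      (trans (sym (toℕ-fromℕ< _)) (trans (cong toℕ e) (toℕ-fromℕ< _))))

window-pigeonhole : ∀ {m} (S : Subset m) (h : Fin m → ℕ) (a b : ℕ) → a ≤ b →
                    (∀ {u} → u ∈ S → a ≤ h u × h u < b) → InjectiveOn S h → ∣ S ∣ + a ≤ b
window-pigeonhole S h a b a≤b window injective =
  subst (∣ S ∣ + a ≤_) (m∸n+n≡m a≤b)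
    (+-monoˡ-≤ a (pigeonhole S (λ u → h u ∸ a) (b ∸ a) shifted-bound shifted-injective))
  where
  shifted-bound : ∀ {u} → u ∈ S → h u ∸ a < b ∸ a
  shifted-bound u∈S = ∸-monoˡ-< (proj₂ (window u∈S)) (proj₁ (window u∈S))
  shifted-injective : InjectiveOn S (λ u → h u ∸ a)
  shifted-injective u∈S w∈S e =
    injective u∈S w∈S (∸-cancelʳ-≡ (proj₁ (window u∈S)) (proj₁ (window w∈S)) e)

outside-nbr : (G : Graph) → Subset (n G) → Fin (n G) → Fin (n G) → Bool
outside-nbr G S v u = adj G v u ∧ not (lookup S u)

-- For v in a clique S, N(v) is S ∖ {v} together with N(v) ∖ S, hence
-- Σ_{N(v)} f + f(v) = Σ_S f + Σ_{N(v)∖S} f.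
clique-nbr-sum : (G : Graph) (S : Subset (n G)) → IsClique G S → ∀ {v} → v ∈ S →
                 (f : Fin (n G) → ℕ) →
                 sumWhere (adj G v) f + f v ≡ sumWhere (lookup S) f + sumWhere (outside-nbr G S v) f
clique-nbr-sum G S clique {v} v∈S f = begin
    sumWhere (adj G v) f + f v
  ≡⟨ cong (_+ f v) (trans (sumWhere-cong f (λ u → nbr-split (adj G v u) (lookup S u)))
                          (sumWhere-∨ inside outside f (λ u → nbr-disjoint (adj G v u) (lookup S u)))) ⟩
    sumWhere inside f + sumWhere outside f + f v
  ≡⟨ +-assoc (sumWhere inside f) _ _ ⟩
    sumWhere inside f + (sumWhere outside f + f v)
  ≡⟨ cong (sumWhere inside f +_) (trans (+-comm _ (f v)) (cong (_+ sumWhere outside f) (sym (sumWhere-point v f)))) ⟩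
    sumWhere inside f + (sumWhere self f + sumWhere outside f)
  ≡⟨ sym (+-assoc (sumWhere inside f) _ _) ⟩
    sumWhere inside f + sumWhere self f + sumWhere outside f
  ≡⟨ cong (_+ sumWhere outside f) (sym (sumWhere-∨ inside self f (λ u → proj₂ (clique-split u)))) ⟩
    sumWhere (λ u → inside u ∨ self u) f + sumWhere outside f
  ≡⟨ cong (_+ sumWhere outside f) (sumWhere-cong f (λ u → proj₁ (clique-split u))) ⟩
    sumWhere (lookup S) f + sumWhere outside f
  ∎
  where
  open ≡-Reasoning
  inside outside self : Fin (n G) → Bool
  inside  u = adj G v u ∧ lookup S u
  outside   = outside-nbr G S v
  self    u = does (u ≟ᶠ v)

  nbr-split : ∀ a s → a ≡ (a ∧ s) ∨ (a ∧ not s)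
  nbr-split true  true  = refl
  nbr-split true  false = refl
  nbr-split false s     = refl

  nbr-disjoint : ∀ a s → (a ∧ s) ∧ (a ∧ not s) ≡ false
  nbr-disjoint true  true  = refl
  nbr-disjoint true  false = refl
  nbr-disjoint false s     = refl

  clique-split : ∀ u → inside u ∨ self u ≡ lookup S u × inside u ∧ self u ≡ false
  clique-split u with u ≟ᶠ v
  ... | yes refl rewrite irref G v | []=⇒lookup v∈S = refl , refl
  ... | no u≢v with lookup S u in u-in
  ...   | false = trans (∨-identityʳ _) (∧-zeroʳ (adj G v u)) , ∧-zeroʳ _
  ...   | true  rewrite clique v u v∈S (lookup⇒[]= u S u-in) (λ e → u≢v (sym e)) = refl , refl

clique-window-bound : (G : Graph) (S : Subset (n G)) → IsClique G S → (r m k : ℕ) → 1 ≤ k →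
                      (∀ v → v ∈ S → deg G v ≡ r) → ∣ S ∣ + m ≡ r + 1 →
                      (ℓ : Fin (n G) → ℕ) → (∀ v → 1 ≤ ℓ v × ℓ v ≤ k) → IsDLucky G ℓ →
                      ∣ S ∣ + m ≤ k * suc m
clique-window-bound G S clique r m k k≥1 regular size ℓ labels lucky =
  +-cancelˡ-≤ base _ _ (subst (_≤ base + k * suc m) (+-comm-middle ∣ S ∣ base m)
    (window-pigeonhole S shifted (base + m) (base + k * suc m) base+m≤ window shifted-injective))
  where
  base : ℕ
  base = r + sumWhere (lookup S) ℓ

  outside : Fin (n G) → Fin (n G) → Bool
  outside = outside-nbr G S

  shifted : Fin (n G) → ℕ
  shifted v = dsum G ℓ v + k

  +-comm-middle : ∀ a b c → a + (b + c) ≡ b + (a + c)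
  +-comm-middle a b c = trans (sym (+-assoc a b c)) (trans (cong (_+ c) (+-comm a b)) (+-assoc b a c))

  base+m≤ : base + m ≤ base + k * suc m
  base+m≤ = +-monoʳ-≤ base (≤-trans (n≤1+n m) (m≤n*m (suc m) k {{>-nonZero k≥1}}))

  outside-count : ∀ {v} → v ∈ S → count (outside v) ≡ m
  outside-count {v} v∈S = +-cancelˡ-≡ ∣ S ∣ _ _ (begin
      ∣ S ∣ + count (outside v)              ≡⟨ cong (_+ count (outside v)) (sym (count-lookup S)) ⟩
      count (lookup S) + count (outside v)   ≡⟨ sym (clique-nbr-sum G S clique v∈S (λ _ → 1)) ⟩
      count (adj G v) + 1                    ≡⟨ cong (_+ 1) (trans (sym (deg≡count G v)) (regular v v∈S)) ⟩
      r + 1                                  ≡⟨ sym size ⟩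
      ∣ S ∣ + m                              ∎)
    where open ≡-Reasoning

  dsum-identity : ∀ {v} → v ∈ S → dsum G ℓ v + ℓ v ≡ base + sumWhere (outside v) ℓ
  dsum-identity {v} v∈S = begin
      dsum G ℓ v + ℓ v
    ≡⟨ cong (_+ ℓ v) (dsum≡sumWhere G ℓ v) ⟩
      count (adj G v) + sumWhere (adj G v) ℓ + ℓ v
    ≡⟨ +-assoc (count (adj G v)) _ _ ⟩
      count (adj G v) + (sumWhere (adj G v) ℓ + ℓ v)
    ≡⟨ cong₂ _+_ (trans (sym (deg≡count G v)) (regular v v∈S)) (clique-nbr-sum G S clique v∈S ℓ) ⟩
      r + (sumWhere (lookup S) ℓ + sumWhere (outside v) ℓ)
    ≡⟨ sym (+-assoc r _ _) ⟩
      base + sumWhere (outside v) ℓ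
    ∎
    where open ≡-Reasoning

  outside-bounds : ∀ {v} → v ∈ S → m ≤ sumWhere (outside v) ℓ × sumWhere (outside v) ℓ ≤ k * m
  outside-bounds {v} v∈S with sumWhere-bounds (outside v) ℓ k labels
  ... | lower , upper rewrite outside-count v∈S = lower , upper

  window : ∀ {v} → v ∈ S → base + m ≤ shifted v × shifted v < base + k * suc m
  window {v} v∈S = lower , upper
    where
    open ≤-Reasoning
    X = sumWhere (outside v) ℓ
    lower : base + m ≤ shifted v
    lower = begin
      base + m           ≤⟨ +-monoʳ-≤ base (proj₁ (outside-bounds v∈S)) ⟩
      base + X           ≡⟨ sym (dsum-identity v∈S) ⟩
      dsum G ℓ v + ℓ v   ≤⟨ +-monoʳ-≤ (dsum G ℓ v) (proj₂ (labels v)) ⟩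
      shifted v          ∎
    upper : shifted v < base + k * suc m
    upper = begin-strict
      dsum G ℓ v + k         <⟨ +-monoˡ-< k (m<m+n (dsum G ℓ v) (proj₁ (labels v))) ⟩
      dsum G ℓ v + ℓ v + k   ≡⟨ cong (_+ k) (dsum-identity v∈S) ⟩
      base + X + k           ≤⟨ +-monoˡ-≤ k (+-monoʳ-≤ base (proj₂ (outside-bounds v∈S))) ⟩
      base + k * m + k       ≡⟨ +-assoc base (k * m) k ⟩
      base + (k * m + k)     ≡⟨ cong (base +_) (trans (+-comm (k * m) k) (sym (*-suc k m))) ⟩
      base + k * suc m       ∎

  -- Distinct vertices of the clique S are adjacent, so a d-lucky ℓ separates them.
  shifted-injective : InjectiveOn S shifted
  shifted-injective {u} {w} u∈S w∈S e with u ≟ᶠ w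
  ... | yes u≡w = u≡w
  ... | no  u≢w = ⊥-elim (lucky u w (clique u w u∈S w∈S u≢w) (+-cancelʳ-≡ k _ _ e))

∸≡suc⇒+≡ : ∀ a b m → a ∸ b ≡ suc m → b + suc m ≡ a
∸≡suc⇒+≡ a b m a∸b≡ = trans (cong (b +_) (sym a∸b≡)) (m+[n∸m]≡n (<⇒≤ (m∸n≢0⇒n<m {a} {b} (λ e → 0≢1+n (trans (sym e) a∸b≡)))))

⌈/⌉-≤ : ∀ a d k → a ≤ k * suc d → ⌈ a / suc d ⌉ ≤ k
⌈/⌉-≤ a d k a≤ = ≤-pred (m<n*o⇒m/o<n {n = suc k}
  (subst (a + d <_) (+-comm (k * suc d) (suc d)) (+-mono-≤-< a≤ (n<1+n d))))

corollary2p2 : (G : Graph) → Connected G → (ω r : ℕ) → IsCliqueNumber G ω →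
    (∀ S → IsClique G S → ∣ S ∣ ≡ ω → ∀ v → v ∈ S → deg G v ≡ r) →
    ∀ k → IsDLuckyNumber G k → ⌈ (r + 1) / ((r + 2) ∸ ω) ⌉ ≤ k
corollary2p2 G _ ω r ((S , clique , ∣S∣≡ω) , _) regular k (k≥1 , (ℓ , labels , lucky) , _)
  with r + 2 ∸ ω in gap
... | zero  = z≤n
... | suc m = ⌈/⌉-≤ (r + 1) m k (subst (_≤ k * suc m) size
                (clique-window-bound G S clique r m k k≥1 (regular S clique ∣S∣≡ω) size ℓ labels lucky))
  where
  size : ∣ S ∣ + m ≡ r + 1
  size = suc-injective (begin
      suc (∣ S ∣ + m)  ≡⟨ sym (+-suc ∣ S ∣ m) ⟩
      ∣ S ∣ + suc m    ≡⟨ cong (_+ suc m) ∣S∣≡ω ⟩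
      ω + suc m        ≡⟨ ∸≡suc⇒+≡ (r + 2) ω m gap ⟩
      r + 2            ≡⟨ +-suc r 1 ⟩
      suc (r + 1)      ∎)
    where open ≡-Reasoning
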